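{- Every strongly anti-pasch Steiner triple system is anti-pasch.
   Context: A Steiner triple system of order $n$ is a pair $(X,S)$ with $|X|=n$ and $S$ a set of 3-subsets of $X$ (blocks) such that every pair of distinct elements of $X$ lies in exactly one block. A pasch configuration is a set of four 3-subsets $\{a,b,c\},\{a,d,e\},\{f,b,d\},\{f,c,e\}$ with $a,b,c,d,e,f$ distinct; $S$ is anti-pasch if no pasch configuration is contained in $S$. The associated quasigroup operation: $a\star a=a$ and for $a\neq b$, $a\star b$ is the third element of the block containing $a,b$. Define $B(S)=\{\{a\star b,b\star c,c\star a\} : a,b,c\in X \text{ distinct}\}$ and $\beta(S)=|B(S)|$. $S$ is called strongly anti-pasch if $\beta(S)=\binom{n}{3}$. -}

module Defs where

open import Data.Nat using (ℕ)
open import Data.Nat.Combinatorics using (_C_)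
open import Data.Fin using (Fin)
open import Data.Fin.Subset using (Subset; ⁅_⁆; _∪_; ∣_∣) renaming (_∈_ to _∈ₛ_)
open import Data.List using (List; []; _∷_; length)
open import Data.List.Membership.Propositional using (_∈_)
open import Data.List.Relation.Unary.All using (All)
open import Data.List.Relation.Unary.Unique.Propositional using (Unique)
open import Data.Product using (Σ; ∃; ∃-syntax; _×_; _,_)
open import Data.Sum using (_⊎_)
open import Function.Bundles using (_⇔_)
open import Relation.Binary.PropositionalEquality using (_≡_; _≢_)

triple : ∀ {n} → Fin n → Fin n → Fin n → Subset n
triple a b c = ⁅ a ⁆ ∪ (⁅ b ⁆ ∪ ⁅ c ⁆)

record TripleSet (n : ℕ) : Set where
  field
    blocks   : List (Subset n)
    unique   : Unique blocks
    size3    : All (λ B → ∣ B ∣ ≡ 3) blocks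
open TripleSet public

IsSTS : ∀ {n} → TripleSet n → Set
IsSTS {n} S =
  ∀ (x y : Fin n) → x ≢ y →
    (∃[ B ] (B ∈ blocks S × x ∈ₛ B × y ∈ₛ B)) ×
    (∀ B B′ → B ∈ blocks S → x ∈ₛ B → y ∈ₛ B →
              B′ ∈ blocks S → x ∈ₛ B′ → y ∈ₛ B′ → B ≡ B′)

Distinct6 : ∀ {n} → Fin n → Fin n → Fin n → Fin n → Fin n → Fin n → Set
Distinct6 a b c d e f = Unique (a ∷ b ∷ c ∷ d ∷ e ∷ f ∷ [])

HasPasch : ∀ {n} → TripleSet n → Set
HasPasch {n} S =
  ∃[ a ] ∃[ b ] ∃[ c ] ∃[ d ] ∃[ e ] ∃[ f ]
    (Distinct6 {n} a b c d e f ×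
     triple a b c ∈ blocks S × triple a d e ∈ blocks S ×
     triple f b d ∈ blocks S × triple f c e ∈ blocks S)

AntiPasch : ∀ {n} → TripleSet n → Set
AntiPasch S = HasPasch S → Data.Empty.⊥
  where import Data.Empty

-- Graph of the quasigroup operation: Star S a b z  means  a ⋆ b = z,
-- where a ⋆ a = a and, for a ≠ b, a ⋆ b is the third point of the block containing a, b.
Star : ∀ {n} → TripleSet n → Fin n → Fin n → Fin n → Set
Star S a b z =
  (a ≡ b × z ≡ a) ⊎
  (a ≢ b × z ≢ a × z ≢ b × triple a b z ∈ blocks S)

InB : ∀ {n} → TripleSet n → Subset n → Set
InB {n} S T =
  ∃[ a ] ∃[ b ] ∃[ c ] (a ≢ b × b ≢ c × a ≢ c ×
    ∃[ x ] ∃[ y ] ∃[ z ] (Star S a b x × Star S b c y × Star S c a z ×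
                          T ≡ triple x y z))

-- β(S) = k : the set B(S) has exactly k elements (witnessed by a duplicate-free
-- list enumerating exactly B(S)).
β≡ : ∀ {n} → TripleSet n → ℕ → Set
β≡ {n} S k = ∃[ L ] (Unique L × (∀ (T : Subset n) → (T ∈ L ⇔ InB S T)) × length L ≡ k)

StronglyAntiPasch : ∀ {n} → TripleSet n → Set
StronglyAntiPasch {n} S = β≡ S (n C 3)

-- In a Steiner triple system, {a,b,c} ↦ {a⋆b, b⋆c, c⋆a} is a well-defined map from the
-- 3-subsets onto B(S), so β(S) = C(n,3) forces it to be injective. But a pasch configuration
-- {a,b,c},{a,d,e},{f,b,d},{f,c,e} sends the two different 3-subsets {a,b,d} and {c,e,f}
-- both to {c,e,f}.
module Submission where

open import Defs
open import Data.Nat using (ℕ; zero; suc; _+_; _≤_; _<_; s≤s; z≤n)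
open import Data.Nat.Properties using (<⇒≱; ≤-reflexive)
open import Data.Nat.Combinatorics using (_C_; nCk+nC[k+1]≡[n+1]C[k+1])
open import Data.Fin using (Fin)
open import Data.Fin.Subset using (Subset; ⁅_⁆; _∪_; ∣_∣; inside; outside; _⊆_) renaming (_∈_ to _∈ₛ_; _∉_ to _∉ₛ_)
open import Data.Fin.Subset.Properties using (x∈⁅x⁆; x∈⁅y⁆⇒x≡y; x∈p∪q⁻; x∈p∪q⁺; ⊆-antisym; ∪-identityˡ; ∪-assoc; ∪-comm; ∣⁅x⁆∣≡1)
open import Data.Bool as Bool using ()
open import Data.Vec using ([]; _∷_; here; there)
open import Data.Vec.Properties using (≡-dec)
open import Data.List using (List; []; _∷_; length; map; _++_)
open import Data.List.Properties using (length-map; length-++; length-removeAt′)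
open import Data.List.Membership.Propositional using (_∈_; _∉_; _─_)
open import Data.List.Membership.Propositional.Properties using (∈-map⁺; ∈-map⁻; ∈-++⁺ˡ; ∈-++⁺ʳ)
import Data.List.Membership.DecPropositional as DecMembership
open import Data.List.Relation.Binary.Subset.Propositional using () renaming (_⊆_ to _⊆ₗ_)
open import Data.List.Relation.Unary.Any using (here; there; index)
open import Data.List.Relation.Unary.All as All using (All; []; _∷_)
open import Data.List.Relation.Unary.All.Properties as All using ()
open import Data.List.Relation.Unary.AllPairs as AllPairs using ([]; _∷_)
import Data.List.Relation.Unary.AllPairs.Properties as AllPairs
open import Data.List.Relation.Unary.Unique.Propositional using (Unique)
open import Data.Product using (∃; ∃-syntax; _×_; _,_; proj₁; proj₂)
open import Data.Sum using (_⊎_; inj₁; inj₂)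
open import Data.Empty using (⊥-elim)
open import Function using (_∘_)
open import Function.Bundles using (Equivalence)
open import Level using (Level)
open import Relation.Nullary using (yes; no)
open import Relation.Binary.Definitions using (DecidableEquality)
open import Relation.Binary.PropositionalEquality using (_≡_; _≢_; refl; sym; trans; cong; cong₂; subst; ≢-sym; module ≡-Reasoning)

private
  variable
    α β γ ρ : Level
    A : Set α
    B : Set β
    D : Set γ

∈-─⁺ : {xs : List A} {x y : A} (x∈xs : x ∈ xs) → y ∈ xs → y ≢ x → y ∈ xs ─ x∈xs
∈-─⁺ (here refl) (here refl) y≢x = ⊥-elim (y≢x refl)
∈-─⁺ (here _)    (there y∈xs) _  = y∈xs
∈-─⁺ (there _)   (here refl) _   = here refl
∈-─⁺ (there x∈xs) (there y∈xs) y≢x = there (∈-─⁺ x∈xs y∈xs y≢x)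

unique-⊆⇒length< : {xs ys : List A} {y : A} → Unique xs → xs ⊆ₗ ys → y ∈ ys → y ∉ xs →
                   length xs < length ys
unique-⊆⇒length< [] _ (here _)  _ = s≤s z≤n
unique-⊆⇒length< [] _ (there _) _ = s≤s z≤n
unique-⊆⇒length< {xs = x ∷ xs} {ys} (x∉xs ∷ uxs) xs⊆ys y∈ys y∉xs
  = subst (length (x ∷ xs) <_) (sym (length-removeAt′ ys (index x∈ys)))
      (s≤s (unique-⊆⇒length< uxs xs⊆ys─x (∈-─⁺ x∈ys y∈ys (y∉xs ∘ here)) (y∉xs ∘ there)))
  where
  x∈ys : x ∈ ys
  x∈ys = xs⊆ys (here refl)
  xs⊆ys─x : xs ⊆ₗ ys ─ x∈ys
  xs⊆ys─x z∈xs = ∈-─⁺ x∈ys (xs⊆ys (there z∈xs)) (≢-sym (All.lookup x∉xs z∈xs))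

module _ (_≟_ : DecidableEquality A) where
  open DecMembership _≟_ using (_∈?_)

  unique-⊆-length≥⇒⊇ : {xs ys : List A} → Unique xs → xs ⊆ₗ ys → length ys ≤ length xs → ys ⊆ₗ xs
  unique-⊆-length≥⇒⊇ {xs} uxs xs⊆ys ∣ys∣≤∣xs∣ {y} y∈ys with y ∈? xs
  ... | yes y∈xs = y∈xs
  ... | no  y∉xs = ⊥-elim (<⇒≱ (unique-⊆⇒length< uxs xs⊆ys y∈ys y∉xs) ∣ys∣≤∣xs∣)

unique-map⇒injective : (f : A → B) {xs : List A} {x y : A} → Unique (map f xs) →
                       x ∈ xs → y ∈ xs → f x ≡ f y → x ≡ y
unique-map⇒injective f (_ ∷ _) (here refl) (here refl) _ = refl
unique-map⇒injective f (fx∉ ∷ _) (here refl) (there y∈xs) fx≡fy =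
  ⊥-elim (All.lookup (All.map⁻ fx∉) y∈xs fx≡fy)
unique-map⇒injective f (fy∉ ∷ _) (there x∈xs) (here refl) fx≡fy =
  ⊥-elim (All.lookup (All.map⁻ fy∉) x∈xs (sym fx≡fy))
unique-map⇒injective f (_ ∷ u) (there x∈xs) (there y∈xs) fx≡fy =
  unique-map⇒injective f u x∈xs y∈xs fx≡fy

unique-map-reflects : (f : A → B) (g : A → D) {xs : List A} → (∀ {x y} → g x ≡ g y → f x ≡ f y) →
                      Unique (map f xs) → Unique (map g xs)
unique-map-reflects f g g≡⇒f≡ =
  AllPairs.map⁺ ∘ AllPairs.map (λ fx≢fy → fx≢fy ∘ g≡⇒f≡) ∘ AllPairs.map⁻

map-proj₁-toList : {P : A → Set ρ} {xs : List A} (pxs : All P xs) → map proj₁ (All.toList pxs) ≡ xs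
map-proj₁-toList []         = refl
map-proj₁-toList (_ ∷ pxs) = cong (_ ∷_) (map-proj₁-toList pxs)

-- The chosen preimages of the elements of L are pairwise distinct elements of M,
-- so by counting they exhaust M.
module _ (_≟_ : DecidableEquality A) (R : A → B → Set ρ)
         (R-functional : ∀ {t T T′} → R t T → R t T′ → T ≡ T′) where

  injective-if-image-not-smaller :
    (M : List A) (L : List B) → Unique L → (∀ {T} → T ∈ L → ∃[ t ] (t ∈ M × R t T)) →
    length M ≤ length L → ∀ {t t′ T} → t ∈ M → t′ ∈ M → R t T → R t′ T → t ≡ t′
  injective-if-image-not-smaller M L unique-L preimage ∣M∣≤∣L∣ {t} {t′} t∈M t′∈M tRT t′RT =
    let q , q∈Q , t≡q , q↦T = chosen-for t∈M tRT
        q′ , q′∈Q , t′≡q′ , q′↦T = chosen-for t′∈M t′RT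
    in begin
      t         ≡⟨ t≡q ⟩
      chosen q  ≡⟨ cong chosen (unique-map⇒injective image unique-image q∈Q q′∈Q
                                  (trans q↦T (sym q′↦T))) ⟩
      chosen q′ ≡⟨ sym t′≡q′ ⟩
      t′        ∎
    where
    open ≡-Reasoning
    Preimage : Set _
    Preimage = ∃ λ T → ∃[ t ] (t ∈ M × R t T)
    image : Preimage → B
    image = proj₁
    chosen : Preimage → A
    chosen = proj₁ ∘ proj₂
    Q : List Preimage
    Q = All.toList (All.tabulate preimage)
    image-Q : map image Q ≡ L
    image-Q = map-proj₁-toList (All.tabulate preimage)
    unique-image : Unique (map image Q)
    unique-image = subst Unique (sym image-Q) unique-L
    unique-chosen : Unique (map chosen Q)
    unique-chosen = unique-map-reflects image chosen
      (λ { {_ , _ , _ , tRT} {_ , _ , _ , tRT′} refl → R-functional tRT tRT′ }) unique-image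
    chosen⊆M : map chosen Q ⊆ₗ M
    chosen⊆M t∈chosen with ∈-map⁻ chosen t∈chosen
    ... | (_ , _ , t∈M , _) , _ , refl = t∈M
    ∣M∣≤∣chosen∣ : length M ≤ length (map chosen Q)
    ∣M∣≤∣chosen∣ = subst (length M ≤_)
      (trans (cong length (sym image-Q)) (trans (length-map image Q) (sym (length-map chosen Q))))
      ∣M∣≤∣L∣
    chosen-for : ∀ {t T} → t ∈ M → R t T → ∃[ q ] (q ∈ Q × t ≡ chosen q × image q ≡ T)
    chosen-for t∈M tRT
      with ∈-map⁻ chosen (unique-⊆-length≥⇒⊇ _≟_ unique-chosen chosen⊆M ∣M∣≤∣chosen∣ t∈M)
    ... | q@(_ , _ , _ , qR) , q∈Q , refl = q , q∈Q , refl , R-functional qR tRT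

combinations : (n k : ℕ) → List (Subset n)
combinations zero    zero    = [] ∷ []
combinations zero    (suc k) = []
combinations (suc n) zero    = map (outside ∷_) (combinations n zero)
combinations (suc n) (suc k) =
  map (inside ∷_) (combinations n k) ++ map (outside ∷_) (combinations n (suc k))

length-combinations : (n k : ℕ) → length (combinations n k) ≡ n C k
length-combinations zero    zero    = refl
length-combinations zero    (suc k) = refl
length-combinations (suc n) zero    =
  trans (length-map _ (combinations n zero)) (length-combinations n zero)
length-combinations (suc n) (suc k) = begin
  length (map (inside ∷_) (combinations n k) ++ map (outside ∷_) (combinations n (suc k)))
    ≡⟨ length-++ (map (inside ∷_) (combinations n k)) ⟩
  length (map (inside ∷_) (combinations n k)) + length (map (outside ∷_) (combinations n (suc k)))
    ≡⟨ cong₂ _+_ (length-map _ (combinations n k)) (length-map _ (combinations n (suc k))) ⟩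
  length (combinations n k) + length (combinations n (suc k))
    ≡⟨ cong₂ _+_ (length-combinations n k) (length-combinations n (suc k)) ⟩
  n C k + n C suc k
    ≡⟨ nCk+nC[k+1]≡[n+1]C[k+1] n k ⟩
  suc n C suc k ∎
  where open ≡-Reasoning

∈-combinations : ∀ {n k} (p : Subset n) → ∣ p ∣ ≡ k → p ∈ combinations n k
∈-combinations []             refl = here refl
∈-combinations (inside ∷ p)   refl = ∈-++⁺ˡ (∈-map⁺ (inside ∷_) (∈-combinations p refl))
∈-combinations {k = zero}  (outside ∷ p) ∣p∣≡0 = ∈-map⁺ (outside ∷_) (∈-combinations p ∣p∣≡0)
∈-combinations {suc n} {suc k} (outside ∷ p) ∣p∣≡k =
  ∈-++⁺ʳ (map (inside ∷_) (combinations n k)) (∈-map⁺ (outside ∷_) (∈-combinations p ∣p∣≡k))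

∣⁅x⁆∪p∣≡1+∣p∣ : ∀ {n} (x : Fin n) (p : Subset n) → x ∉ₛ p → ∣ ⁅ x ⁆ ∪ p ∣ ≡ suc ∣ p ∣
∣⁅x⁆∪p∣≡1+∣p∣ Fin.zero    (inside ∷ p)  x∉p = ⊥-elim (x∉p here)
∣⁅x⁆∪p∣≡1+∣p∣ Fin.zero    (outside ∷ p) _   = cong (suc ∘ ∣_∣) (∪-identityˡ p)
∣⁅x⁆∪p∣≡1+∣p∣ (Fin.suc x) (inside ∷ p)  x∉p = cong suc (∣⁅x⁆∪p∣≡1+∣p∣ x p (x∉p ∘ there))
∣⁅x⁆∪p∣≡1+∣p∣ (Fin.suc x) (outside ∷ p) x∉p = ∣⁅x⁆∪p∣≡1+∣p∣ x p (x∉p ∘ there)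

module _ {n : ℕ} where

  ∈-triple⁻ : {w x y z : Fin n} → w ∈ₛ triple x y z → w ≡ x ⊎ w ≡ y ⊎ w ≡ z
  ∈-triple⁻ {x = x} {y} {z} w∈xyz with x∈p∪q⁻ ⁅ x ⁆ (⁅ y ⁆ ∪ ⁅ z ⁆) w∈xyz
  ... | inj₁ w∈x = inj₁ (x∈⁅y⁆⇒x≡y x w∈x)
  ... | inj₂ w∈yz with x∈p∪q⁻ ⁅ y ⁆ ⁅ z ⁆ w∈yz
  ...   | inj₁ w∈y = inj₂ (inj₁ (x∈⁅y⁆⇒x≡y y w∈y))
  ...   | inj₂ w∈z = inj₂ (inj₂ (x∈⁅y⁆⇒x≡y z w∈z))

  ∈-triple₁ : {x y z : Fin n} → x ∈ₛ triple x y z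
  ∈-triple₁ {x} = x∈p∪q⁺ (inj₁ (x∈⁅x⁆ x))

  ∈-triple₂ : {x y z : Fin n} → y ∈ₛ triple x y z
  ∈-triple₂ {x} {y} = x∈p∪q⁺ {p = ⁅ x ⁆} (inj₂ (x∈p∪q⁺ (inj₁ (x∈⁅x⁆ y))))

  ∈-triple₃ : {x y z : Fin n} → z ∈ₛ triple x y z
  ∈-triple₃ {x} {y} {z} = x∈p∪q⁺ {p = ⁅ x ⁆} (inj₂ (x∈p∪q⁺ {p = ⁅ y ⁆} (inj₂ (x∈⁅x⁆ z))))

  triple-⊆ : {x y z : Fin n} {p : Subset n} → x ∈ₛ p → y ∈ₛ p → z ∈ₛ p → triple x y z ⊆ p
  triple-⊆ x∈p y∈p z∈p w∈xyz with ∈-triple⁻ w∈xyz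
  ... | inj₁ refl        = x∈p
  ... | inj₂ (inj₁ refl) = y∈p
  ... | inj₂ (inj₂ refl) = z∈p

  triple-rotate : (x y z : Fin n) → triple x y z ≡ triple y z x
  triple-rotate x y z = trans (∪-comm ⁅ x ⁆ (⁅ y ⁆ ∪ ⁅ z ⁆)) (∪-assoc ⁅ y ⁆ ⁅ z ⁆ ⁅ x ⁆)

  triple-swap : (x y z : Fin n) → triple x y z ≡ triple y x z
  triple-swap x y z = begin
    ⁅ x ⁆ ∪ (⁅ y ⁆ ∪ ⁅ z ⁆) ≡⟨ ∪-assoc ⁅ x ⁆ ⁅ y ⁆ ⁅ z ⁆ ⟨
    (⁅ x ⁆ ∪ ⁅ y ⁆) ∪ ⁅ z ⁆ ≡⟨ cong (_∪ ⁅ z ⁆) (∪-comm ⁅ x ⁆ ⁅ y ⁆) ⟩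
    (⁅ y ⁆ ∪ ⁅ x ⁆) ∪ ⁅ z ⁆ ≡⟨ ∪-assoc ⁅ y ⁆ ⁅ x ⁆ ⁅ z ⁆ ⟩
    ⁅ y ⁆ ∪ (⁅ x ⁆ ∪ ⁅ z ⁆) ∎
    where open ≡-Reasoning

  ∣triple∣≡3 : {x y z : Fin n} → x ≢ y → x ≢ z → y ≢ z → ∣ triple x y z ∣ ≡ 3
  ∣triple∣≡3 {x} {y} {z} x≢y x≢z y≢z = begin
    ∣ ⁅ x ⁆ ∪ (⁅ y ⁆ ∪ ⁅ z ⁆) ∣ ≡⟨ ∣⁅x⁆∪p∣≡1+∣p∣ x (⁅ y ⁆ ∪ ⁅ z ⁆) x∉yz ⟩
    suc ∣ ⁅ y ⁆ ∪ ⁅ z ⁆ ∣       ≡⟨ cong suc (∣⁅x⁆∪p∣≡1+∣p∣ y ⁅ z ⁆ (y≢z ∘ x∈⁅y⁆⇒x≡y z)) ⟩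
    suc (suc ∣ ⁅ z ⁆ ∣)         ≡⟨ cong (suc ∘ suc) (∣⁅x⁆∣≡1 z) ⟩
    3                           ∎
    where
    open ≡-Reasoning
    x∉yz : x ∉ₛ ⁅ y ⁆ ∪ ⁅ z ⁆
    x∉yz x∈yz with x∈p∪q⁻ ⁅ y ⁆ ⁅ z ⁆ x∈yz
    ... | inj₁ x∈y = x≢y (x∈⁅y⁆⇒x≡y y x∈y)
    ... | inj₂ x∈z = x≢z (x∈⁅y⁆⇒x≡y z x∈z)

Derived : ∀ {n} → TripleSet n → Subset n → Subset n → Set
Derived S t T =
  ∃[ a ] ∃[ b ] ∃[ c ] (a ≢ b × b ≢ c × a ≢ c × t ≡ triple a b c ×
    ∃[ x ] ∃[ y ] ∃[ z ] (Star S a b x × Star S b c y × Star S c a z × T ≡ triple x y z))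

module _ {n : ℕ} (S : TripleSet n) where

  block⇒star : {x y z : Fin n} → x ≢ y → x ≢ z → y ≢ z → triple x y z ∈ blocks S → Star S x y z
  block⇒star x≢y x≢z y≢z xyz∈S = inj₂ (x≢y , ≢-sym x≢z , ≢-sym y≢z , xyz∈S)

  star-sym : {x y z : Fin n} → Star S x y z → Star S y x z
  star-sym (inj₁ (x≡y , z≡x)) = inj₁ (sym x≡y , trans z≡x x≡y)
  star-sym {x} {y} {z} (inj₂ (x≢y , z≢x , z≢y , xyz∈S)) =
    inj₂ (≢-sym x≢y , z≢y , z≢x , subst (_∈ blocks S) (triple-swap x y z) xyz∈S)

  star-rotate : {x y z : Fin n} → Star S x y z → Star S y z x
  star-rotate (inj₁ (x≡y , z≡x)) = inj₁ (trans (sym x≡y) (sym z≡x) , x≡y)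
  star-rotate {x} {y} {z} (inj₂ (x≢y , z≢x , z≢y , xyz∈S)) =
    inj₂ (≢-sym z≢y , x≢y , ≢-sym z≢x , subst (_∈ blocks S) (triple-rotate x y z) xyz∈S)

  inB⇒derived : {T : Subset n} → InB S T → ∃[ t ] Derived S t T
  inB⇒derived (a , b , c , a≢b , b≢c , a≢c , stars) =
    triple a b c , a , b , c , a≢b , b≢c , a≢c , refl , stars

  derived⇒∈combinations : {t T : Subset n} → Derived S t T → t ∈ combinations n 3
  derived⇒∈combinations (_ , _ , _ , a≢b , b≢c , a≢c , refl , _) =
    ∈-combinations _ (∣triple∣≡3 a≢b a≢c b≢c)

  module _ (sts : IsSTS S) where

    star-functional : {x y z z′ : Fin n} → Star S x y z → Star S x y z′ → z ≡ z′
    star-functional (inj₁ (_ , z≡x)) (inj₁ (_ , z′≡x)) = trans z≡x (sym z′≡x)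
    star-functional (inj₁ (x≡y , _)) (inj₂ (x≢y , _)) = ⊥-elim (x≢y x≡y)
    star-functional (inj₂ (x≢y , _)) (inj₁ (x≡y , _)) = ⊥-elim (x≢y x≡y)
    star-functional {x} {y} {z} {z′} (inj₂ (x≢y , z≢x , z≢y , xyz∈S)) (inj₂ (_ , _ , _ , xyz′∈S))
      with ∈-triple⁻ (subst (z ∈ₛ_) same-block ∈-triple₃)
      where
      same-block : triple x y z ≡ triple x y z′
      same-block = proj₂ (sts x y x≢y) _ _ xyz∈S ∈-triple₁ ∈-triple₂ xyz′∈S ∈-triple₁ ∈-triple₂
    ... | inj₁ z≡x        = ⊥-elim (z≢x z≡x)
    ... | inj₂ (inj₁ z≡y) = ⊥-elim (z≢y z≡y)
    ... | inj₂ (inj₂ z≡z′) = z≡z′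

    star-closed : {a b c x y z u v w : Fin n} →
                  Star S a b x → Star S b c y → Star S c a z →
                  u ∈ₛ triple a b c → v ∈ₛ triple a b c → u ≢ v → Star S u v w →
                  w ∈ₛ triple x y z
    star-closed ab bc ca u∈ v∈ u≢v uv with ∈-triple⁻ u∈ | ∈-triple⁻ v∈
    ... | inj₁ refl        | inj₁ refl        = ⊥-elim (u≢v refl)
    ... | inj₂ (inj₁ refl) | inj₂ (inj₁ refl) = ⊥-elim (u≢v refl)
    ... | inj₂ (inj₂ refl) | inj₂ (inj₂ refl) = ⊥-elim (u≢v refl)
    ... | inj₁ refl        | inj₂ (inj₁ refl) = subst (_∈ₛ _) (star-functional ab uv) ∈-triple₁
    ... | inj₂ (inj₁ refl) | inj₂ (inj₂ refl) = subst (_∈ₛ _) (star-functional bc uv) ∈-triple₂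
    ... | inj₂ (inj₂ refl) | inj₁ refl        = subst (_∈ₛ _) (star-functional ca uv) ∈-triple₃
    ... | inj₂ (inj₁ refl) | inj₁ refl        = subst (_∈ₛ _) (star-functional (star-sym ab) uv) ∈-triple₁
    ... | inj₂ (inj₂ refl) | inj₂ (inj₁ refl) = subst (_∈ₛ _) (star-functional (star-sym bc) uv) ∈-triple₂
    ... | inj₁ refl        | inj₂ (inj₂ refl) = subst (_∈ₛ _) (star-functional (star-sym ca) uv) ∈-triple₃

    derived-⊆ : {t T T′ : Subset n} → Derived S t T → Derived S t T′ → T ⊆ T′
    derived-⊆ (a , b , c , a≢b , b≢c , a≢c , refl , x , y , z , ab , bc , ca , refl)
              (a′ , b′ , c′ , _ , _ , _ , abc≡ , x′ , y′ , z′ , ab′ , bc′ , ca′ , refl) =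
      triple-⊆ (closed ∈-triple₁ ∈-triple₂ a≢b ab)
               (closed ∈-triple₂ ∈-triple₃ b≢c bc)
               (closed ∈-triple₃ ∈-triple₁ (≢-sym a≢c) ca)
      where
      closed : {u v w : Fin n} → u ∈ₛ triple a b c → v ∈ₛ triple a b c → u ≢ v → Star S u v w →
               w ∈ₛ triple x′ y′ z′
      closed {u} {v} u∈ v∈ =
        star-closed ab′ bc′ ca′ (subst (u ∈ₛ_) abc≡ u∈) (subst (v ∈ₛ_) abc≡ v∈)

    derived-functional : {t T T′ : Subset n} → Derived S t T → Derived S t T′ → T ≡ T′
    derived-functional tT tT′ = ⊆-antisym (derived-⊆ tT tT′) (derived-⊆ tT′ tT)

    derived-injective : StronglyAntiPasch S → {t t′ T : Subset n} →
                        Derived S t T → Derived S t′ T → t ≡ t′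
    derived-injective (L , unique-L , L⇔B , ∣L∣≡nC3) tT t′T =
      injective-if-image-not-smaller (≡-dec Bool._≟_) (Derived S) derived-functional
        (combinations n 3) L unique-L preimage
        (≤-reflexive (trans (length-combinations n 3) (sym ∣L∣≡nC3)))
        (derived⇒∈combinations tT) (derived⇒∈combinations t′T) tT t′T
      where
      preimage : {T : Subset n} → T ∈ L → ∃[ t ] (t ∈ combinations n 3 × Derived S t T)
      preimage {T} T∈L with inB⇒derived (Equivalence.to (L⇔B T) T∈L)
      ... | t , tT = t , derived⇒∈combinations tT , tT

pasch⇒derived-collision : ∀ {n} (S : TripleSet n) → HasPasch S →
                          ∃[ t ] ∃[ t′ ] ∃[ T ] (t ≢ t′ × Derived S t T × Derived S t′ T)
pasch⇒derived-collision S
  (a , b , c , d , e , f ,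
   ((a≢b ∷ a≢c ∷ a≢d ∷ a≢e ∷ a≢f ∷ []) ∷ (b≢c ∷ b≢d ∷ _ ∷ b≢f ∷ []) ∷ (_ ∷ c≢e ∷ c≢f ∷ []) ∷
    (d≢e ∷ d≢f ∷ []) ∷ (e≢f ∷ []) ∷ [] ∷ []) ,
   abc∈S , ade∈S , fbd∈S , fce∈S) =
  triple b a d , triple e f c , triple c e f , bad≢efc ,
  (b , a , d , ≢-sym a≢b , a≢d , b≢d , refl , c , e , f , b⋆a , a⋆d , d⋆b , refl) ,
  (e , f , c , e≢f , ≢-sym c≢f , ≢-sym c≢e , refl , c , e , f , e⋆f , f⋆c , c⋆e , refl)
  where
  b⋆a : Star S b a c
  b⋆a = star-sym S (block⇒star S a≢b a≢c b≢c abc∈S)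
  a⋆d : Star S a d e
  a⋆d = block⇒star S a≢d a≢e d≢e ade∈S
  d⋆b : Star S d b f
  d⋆b = star-sym S (star-rotate S (block⇒star S (≢-sym b≢f) (≢-sym d≢f) b≢d fbd∈S))
  f⋆c : Star S f c e
  f⋆c = block⇒star S (≢-sym c≢f) (≢-sym e≢f) c≢e fce∈S
  c⋆e : Star S c e f
  c⋆e = star-rotate S f⋆c
  e⋆f : Star S e f c
  e⋆f = star-rotate S c⋆e
  bad≢efc : triple b a d ≢ triple e f c
  bad≢efc bad≡efc with ∈-triple⁻ (subst (a ∈ₛ_) bad≡efc ∈-triple₂)
  ... | inj₁ a≡e        = a≢e a≡e
  ... | inj₂ (inj₁ a≡f) = a≢f a≡f
  ... | inj₂ (inj₂ a≡c) = a≢c a≡c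

corollary2p7 : (n : ℕ) (S : TripleSet n) → IsSTS S → StronglyAntiPasch S → AntiPasch S
corollary2p7 n S sts strongly-anti-pasch pasch =
  let t , t′ , T , t≢t′ , tT , t′T = pasch⇒derived-collision S pasch
  in t≢t′ (derived-injective S sts strongly-anti-pasch tT t′T)
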